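{- Let $n\ge4$ be an integer, let $\beta$ be the largest real root of $p_n(x)=x^3-(n+1)x^2+nx-n$, $\alpha=\beta-n$, and $f(l,k,j)=l-\alpha k+\frac{\alpha}{\beta}j$. Let $(l,k,j)\in\mathbb{Z}^3$ satisfy $0<f(l,k,j)<1$, and let $m=\max\{|k|,|j|\}$, $\mu=\min\{|k|,|j|\}$. (a) If $k>0$ and $j<0$, then \[k-j-l>m\frac{n-2}{n-1}+\mu\frac{n^2-3n+1}{n^2-3n+2}-1>0.\] (b) If $k<0$ and $j>0$, then \[k-j-l<-m\frac{n-2}{n-1}-\mu\frac{n^2-3n+1}{n^2-3n+2}.\]
   Context: In the paper, $U=\{(l,k,j)\in\mathbb{Z}^3: f(l,k,j)\in[0,1)\}$ and $U^*=U\setminus\{(0,0,0)\}$; the condition $0<f(l,k,j)<1$ is $(l,k,j)\in U^*$. -}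

module Defs where

open import Data.Nat using (ℕ; zero; suc)
open import Data.Integer as ℤ using (ℤ; +_; -[1+_])
open import Data.Product using (∃; _×_)
open import Data.Sum using (_⊎_)
open import Relation.Binary.PropositionalEquality using (_≡_; _≢_)
open import Relation.Nullary using (¬_)

-- The real numbers, axiomatised as a (Dedekind/sup-)complete ordered field.
-- Any model of this record is (isomorphic to) ℝ; the theorem is stated for
-- every such model.
record RealField : Set₁ where
  infixl 6 _+_
  infixl 7 _*_
  infix  4 _<_
  field
    Carrier : Set
    0# 1#   : Carrier
    _+_ _*_ : Carrier → Carrier → Carrier
    -_      : Carrier → Carrier
    _⁻¹     : Carrier → Carrier      -- total; 0⁻¹ is unspecified
    _<_     : Carrier → Carrier → Set
    +-assoc     : ∀ x y z → (x + y) + z ≡ x + (y + z)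
    +-comm      : ∀ x y → x + y ≡ y + x
    +-identityˡ : ∀ x → 0# + x ≡ x
    -‿inverseˡ  : ∀ x → (- x) + x ≡ 0#
    *-assoc     : ∀ x y z → (x * y) * z ≡ x * (y * z)
    *-comm      : ∀ x y → x * y ≡ y * x
    *-identityˡ : ∀ x → 1# * x ≡ x
    distribˡ    : ∀ x y z → x * (y + z) ≡ x * y + x * z
    0≢1         : 0# ≢ 1#
    ⁻¹-inverseʳ : ∀ x → x ≢ 0# → x * (x ⁻¹) ≡ 1#
    <-irrefl    : ∀ x → ¬ (x < x)
    <-trans     : ∀ {x y z} → x < y → y < z → x < z
    <-trichotomy : ∀ x y → (x < y) ⊎ ((x ≡ y) ⊎ (y < x))
    +-mono-<    : ∀ {x y} z → x < y → x + z < y + z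
    *-pos       : ∀ {x y} → 0# < x → 0# < y → 0# < x * y
    sup : (P : Carrier → Set) → ∃ P →
          ∃ (λ b → ∀ x → P x → (x < b ⊎ x ≡ b)) →
          ∃ (λ s → (∀ x → P x → (x < s ⊎ x ≡ s)) ×
                   (∀ b → (∀ x → P x → (x < b ⊎ x ≡ b)) → (s < b ⊎ s ≡ b)))

module RF (R : RealField) where
  open RealField R public

  infix 4 _≤_
  _≤_ : Carrier → Carrier → Set
  x ≤ y = x < y ⊎ x ≡ y

  infixl 6 _-_
  _-_ : Carrier → Carrier → Carrier
  x - y = x + (- y)

  infixl 7 _/_
  _/_ : Carrier → Carrier → Carrier
  x / y = x * (y ⁻¹)

  fromℕ : ℕ → Carrier
  fromℕ zero    = 0#
  fromℕ (suc n) = 1# + fromℕ n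

  fromℤ : ℤ → Carrier
  fromℤ (+ n)      = fromℕ n
  fromℤ -[1+ n ]   = - fromℕ (suc n)

  pₙ : ℕ → Carrier → Carrier
  pₙ n x = x * x * x - fromℕ (suc n) * (x * x) + fromℕ n * x - fromℕ n

  IsLargestRoot : (Carrier → Carrier) → Carrier → Set
  IsLargestRoot p β = (p β ≡ 0#) × (∀ y → p y ≡ 0# → y ≤ β)

  f : ℕ → Carrier → ℤ → ℤ → ℤ → Carrier
  f n β l k j = fromℤ l - α * fromℤ k + (α / β) * fromℤ j
    where α = β - fromℕ n

  bound : ℕ → ℕ → ℕ → Carrier
  bound n m μ =
      fromℕ m * (fromℤ (+ n ℤ.- + 2) / fromℤ (+ n ℤ.- + 1))
    + fromℕ μ * (fromℤ (+ n ℤ.* + n ℤ.- + 3 ℤ.* + n ℤ.+ + 1)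
                 / fromℤ (+ n ℤ.* + n ℤ.- + 3 ℤ.* + n ℤ.+ + 2))

{-# OPTIONS --safe #-}
-- Writing pₙ(x) = x(x-1)(x-n) - n shows that pₙ < 0 on (-∞, n], so β > n, α = β - n > 0 and
-- αβ(β-1) = n.  This identity gives n(1 - α(n-1)) = α²(α + 2n - 1) > 0 and
-- β(1 - (α/β)(n-1)(n-2)) = α + 2 + (n-2)(1 - α(n-1)) > 0, which say that the coefficients
-- c₁ = (n-2)/(n-1) and c₂ = (n²-3n+1)/(n²-3n+2) of the bound satisfy c₁ < 1-α < 1-α/β and
-- c₂ < 1-α/β.  As k - j - l = (1-α)k - (1-α/β)j - f(l,k,j), in case (a) k - j - l is
-- (1-α)|k| + (1-α/β)|j| - f and in case (b) it is -((1-α)|k| + (1-α/β)|j| + f).  Giving the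
-- larger of |k|, |j| the coefficient c₁ shows (1-α)|k| + (1-α/β)|j| ≥ m c₁ + μ c₂, and 0 < f < 1
-- finishes.  Finally c₁ + c₂ > 1, so in case (a), where m, μ ≥ 1, the bound exceeds 1.
module Submission where

open import Defs
open import Algebra.Bundles using (CommutativeRing)
open import Algebra.Structures using (IsCommutativeRing)
open import Algebra.Consequences.Propositional
  using (comm∧idˡ⇒id; comm∧invˡ⇒inv; comm∧distrˡ⇒distrʳ)
open import Algebra.Solver.Ring.AlmostCommutativeRing
  using (fromCommutativeRing; _-Raw-AlmostCommutative⟶_)
import Algebra.Properties.CommutativeSemigroup as CommutativeSemigroupProperties
import Algebra.Properties.Ring as RingProperties
import Algebra.Properties.Semiring.Mult as SemiringMult
import Algebra.Properties.Semiring.Mult.TCOptimised as SemiringMultTCOptimised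
import Algebra.Solver.Ring as RingSolver
open import Data.Empty using (⊥-elim)
open import Data.Integer as ℤ using (ℤ; +_; -[1+_]; +[1+_])
import Data.Integer.Properties as ℤ
open import Data.Maybe using (map)
open import Data.Nat as ℕ using (ℕ; zero; suc)
import Data.Nat.Properties as ℕ
open import Data.Product using (_×_; _,_)
open import Data.Sum using (_⊎_; inj₁; inj₂)
open import Relation.Binary.Consequences using (dec⇒weaklyDec)
open import Relation.Binary.Definitions using (WeaklyDecidable)
open import Relation.Binary.PropositionalEquality

module OrderedField (R : RealField) where
  open RF R

  isCommutativeRing : IsCommutativeRing _≡_ _+_ _*_ -_ 0# 1#
  isCommutativeRing = record
    { isRing = record
      { +-isAbelianGroup = record
        { isGroup = record
          { isMonoid = record
            { isSemigroup = record
              { isMagma = record { isEquivalence = isEquivalence ; ∙-cong = cong₂ _+_ }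
              ; assoc = +-assoc
              }
            ; identity = comm∧idˡ⇒id +-comm +-identityˡ
            }
          ; inverse = comm∧invˡ⇒inv +-comm -‿inverseˡ
          ; ⁻¹-cong = cong (λ x → - x)
          }
        ; comm = +-comm
        }
      ; *-cong = cong₂ _*_
      ; *-assoc = *-assoc
      ; *-identity = comm∧idˡ⇒id *-comm *-identityˡ
      ; distrib = distribˡ , comm∧distrˡ⇒distrʳ *-comm distribˡ
      }
    ; *-comm = *-comm
    }

  commutativeRing : CommutativeRing _ _
  commutativeRing = record { isCommutativeRing = isCommutativeRing }

  open CommutativeRing commutativeRing public
    using (+-identityʳ; *-identityʳ; +-congˡ; +-congʳ; *-congʳ; -‿inverseʳ; zeroˡ; zeroʳ; semiring; +-commutativeSemigroup; ring)
  open CommutativeSemigroupProperties +-commutativeSemigroup using (interchange)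
  open RingProperties ring public
    using (-0#≈0#; -‿involutive; -‿+-comm; x∙y⁻¹≈ε⇒x≈y; -‿distribʳ-*; -‿distribˡ-*)
  open SemiringMult semiring using (×-homo-+; ×1-homo-*) renaming (_×_ to _×ᵤ_)
  open SemiringMultTCOptimised semiring using (×ᵤ≈×) renaming (_×_ to _×′_)

  fromℕ≗×1# : ∀ n → fromℕ n ≡ n ×ᵤ 1#
  fromℕ≗×1# zero    = refl
  fromℕ≗×1# (suc n) = +-congˡ (fromℕ≗×1# n)

  fromℕ-+ : ∀ m n → fromℕ (m ℕ.+ n) ≡ fromℕ m + fromℕ n
  fromℕ-+ m n = begin
    fromℕ (m ℕ.+ n)     ≡⟨ fromℕ≗×1# (m ℕ.+ n) ⟩
    (m ℕ.+ n) ×ᵤ 1#     ≡⟨ ×-homo-+ 1# m n ⟩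
    m ×ᵤ 1# + n ×ᵤ 1#   ≡⟨ sym (cong₂ _+_ (fromℕ≗×1# m) (fromℕ≗×1# n)) ⟩
    fromℕ m + fromℕ n   ∎
    where open ≡-Reasoning

  fromℕ-* : ∀ m n → fromℕ (m ℕ.* n) ≡ fromℕ m * fromℕ n
  fromℕ-* m n = begin
    fromℕ (m ℕ.* n)         ≡⟨ fromℕ≗×1# (m ℕ.* n) ⟩
    (m ℕ.* n) ×ᵤ 1#         ≡⟨ ×1-homo-* m n ⟩
    (m ×ᵤ 1#) * (n ×ᵤ 1#)   ≡⟨ sym (cong₂ _*_ (fromℕ≗×1# m) (fromℕ≗×1# n)) ⟩
    fromℕ m * fromℕ n       ∎
    where open ≡-Reasoning

  x+y-[x+z]≡y-z : ∀ x y z → (x + y) - (x + z) ≡ y - z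
  x+y-[x+z]≡y-z x y z = begin
    (x + y) + - (x + z)      ≡⟨ +-congˡ (sym (-‿+-comm x z)) ⟩
    (x + y) + (- x + - z)    ≡⟨ interchange x y (- x) (- z) ⟩
    (x + - x) + (y + - z)    ≡⟨ +-congʳ (-‿inverseʳ x) ⟩
    0# + (y - z)             ≡⟨ +-identityˡ (y - z) ⟩
    y - z                    ∎
    where open ≡-Reasoning

  fromℤ-⊖ : ∀ m n → fromℤ (m ℤ.⊖ n) ≡ fromℕ m - fromℕ n
  fromℤ-⊖ m       zero    = begin
    fromℤ (m ℤ.⊖ 0)   ≡⟨ cong fromℤ (ℤ.⊖-≥ {m} ℕ.z≤n) ⟩
    fromℕ m           ≡⟨ sym (+-identityʳ (fromℕ m)) ⟩
    fromℕ m + 0#      ≡⟨ +-congˡ (sym -0#≈0#) ⟩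
    fromℕ m - 0#      ∎
    where open ≡-Reasoning
  fromℤ-⊖ zero    (suc n) = trans (cong fromℤ (ℤ.⊖-≤ {0} {suc n} ℕ.z≤n)) (sym (+-identityˡ _))
  fromℤ-⊖ (suc m) (suc n) = begin
    fromℤ (suc m ℤ.⊖ suc n)            ≡⟨ cong fromℤ (ℤ.[1+m]⊖[1+n]≡m⊖n m n) ⟩
    fromℤ (m ℤ.⊖ n)                    ≡⟨ fromℤ-⊖ m n ⟩
    fromℕ m - fromℕ n                  ≡⟨ sym (x+y-[x+z]≡y-z 1# (fromℕ m) (fromℕ n)) ⟩
    fromℕ (suc m) - fromℕ (suc n)      ∎
    where open ≡-Reasoning

  fromℤ-+ : ∀ i j → fromℤ (i ℤ.+ j) ≡ fromℤ i + fromℤ j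
  fromℤ-+ (+ m)      (+ n)      = fromℕ-+ m n
  fromℤ-+ (+ m)      -[1+ n ]   = fromℤ-⊖ m (suc n)
  fromℤ-+ -[1+ m ]   (+ n)      = trans (fromℤ-⊖ n (suc m)) (+-comm _ _)
  fromℤ-+ -[1+ m ]   -[1+ n ]   = begin
    - fromℕ (suc (suc (m ℕ.+ n)))            ≡⟨ cong (λ t → - fromℕ (suc t)) (sym (ℕ.+-suc m n)) ⟩
    - fromℕ (suc m ℕ.+ suc n)                ≡⟨ cong (λ x → - x) (fromℕ-+ (suc m) (suc n)) ⟩
    - (fromℕ (suc m) + fromℕ (suc n))        ≡⟨ sym (-‿+-comm _ _) ⟩
    - fromℕ (suc m) + - fromℕ (suc n)        ∎
    where open ≡-Reasoning

  fromℤ-neg : ∀ i → fromℤ (ℤ.- i) ≡ - fromℤ i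
  fromℤ-neg (+ zero)  = sym -0#≈0#
  fromℤ-neg +[1+ n ]  = refl
  fromℤ-neg -[1+ n ]  = sym (-‿involutive _)

  fromℤ-‿ : ∀ i j → fromℤ (i ℤ.- j) ≡ fromℤ i - fromℤ j
  fromℤ-‿ i j = trans (fromℤ-+ i (ℤ.- j)) (+-congˡ (fromℤ-neg j))

  fromℤ-*-pos : ∀ m j → fromℤ (+ m ℤ.* j) ≡ fromℕ m * fromℤ j
  fromℤ-*-pos m (+ n)     = trans (cong fromℤ (sym (ℤ.pos-* m n))) (fromℕ-* m n)
  fromℤ-*-pos m -[1+ n ]  = begin
    fromℤ (+ m ℤ.* -[1+ n ])            ≡⟨ cong fromℤ (sym (ℤ.neg-distribʳ-* (+ m) +[1+ n ])) ⟩
    fromℤ (ℤ.- (+ m ℤ.* +[1+ n ]))      ≡⟨ fromℤ-neg (+ m ℤ.* +[1+ n ]) ⟩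
    - fromℤ (+ m ℤ.* +[1+ n ])          ≡⟨ cong (λ x → - x) (fromℤ-*-pos m +[1+ n ]) ⟩
    - (fromℕ m * fromℕ (suc n))         ≡⟨ -‿distribʳ-* _ _ ⟩
    fromℕ m * - fromℕ (suc n)           ∎
    where open ≡-Reasoning

  fromℤ-* : ∀ i j → fromℤ (i ℤ.* j) ≡ fromℤ i * fromℤ j
  fromℤ-* (+ m)     j = fromℤ-*-pos m j
  fromℤ-* -[1+ m ]  j = begin
    fromℤ (-[1+ m ] ℤ.* j)              ≡⟨ cong fromℤ (sym (ℤ.neg-distribˡ-* +[1+ m ] j)) ⟩
    fromℤ (ℤ.- (+[1+ m ] ℤ.* j))        ≡⟨ fromℤ-neg (+[1+ m ] ℤ.* j) ⟩
    - fromℤ (+[1+ m ] ℤ.* j)            ≡⟨ cong (λ x → - x) (fromℤ-*-pos (suc m) j) ⟩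
    - (fromℕ (suc m) * fromℤ j)         ≡⟨ -‿distribˡ-* _ _ ⟩
    - fromℕ (suc m) * fromℤ j           ∎
    where open ≡-Reasoning

  -- The solver reads its constant con (+ 1) as ι (+ 1), which must be 1# on the nose;
  -- fromℤ (+ 1) is only 1# + 0#.
  ι : ℤ → Carrier
  ι (+ n)     = n ×′ 1#
  ι -[1+ n ]  = - (suc n ×′ 1#)

  ι≗fromℤ : ∀ i → ι i ≡ fromℤ i
  ι≗fromℤ (+ n)     = sym (trans (fromℕ≗×1# n) (×ᵤ≈× n 1#))
  ι≗fromℤ -[1+ n ]  = cong (λ x → - x) (ι≗fromℤ +[1+ n ])

  ι-homomorphism : ℤ.+-*-rawRing -Raw-AlmostCommutative⟶ fromCommutativeRing commutativeRing
  ι-homomorphism = record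
    { ⟦_⟧    = ι
    ; +-homo = λ i j → via (ℤ._+_ i j) (fromℤ-+ i j) (cong₂ _+_ (ι≗fromℤ i) (ι≗fromℤ j))
    ; *-homo = λ i j → via (ℤ._*_ i j) (fromℤ-* i j) (cong₂ _*_ (ι≗fromℤ i) (ι≗fromℤ j))
    ; -‿homo = λ i → via (ℤ.- i) (fromℤ-neg i) (cong (λ x → - x) (ι≗fromℤ i))
    ; 0-homo = refl
    ; 1-homo = refl
    }
    where
    via : ∀ i {x y} → fromℤ i ≡ x → y ≡ x → ι i ≡ y
    via i e₁ e₂ = trans (ι≗fromℤ i) (trans e₁ (sym e₂))

  ι-≟ : WeaklyDecidable (λ i j → ι i ≡ ι j)
  ι-≟ i j = map (cong ι) (dec⇒weaklyDec ℤ._≟_ i j)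

  open RingSolver ℤ.+-*-rawRing (fromCommutativeRing commutativeRing) ι-homomorphism ι-≟ public
    using (solve; _:=_; con; _:+_; _:-_; _:*_; :-_)

  Positive NonNegative : Carrier → Set
  Positive x    = 0# < x
  NonNegative x = 0# ≤ x

  private
    variable
      x y z u v : Carrier

  <-≤-dichotomy : ∀ x y → x < y ⊎ y ≤ x
  <-≤-dichotomy x y with <-trichotomy x y
  ... | inj₁ x<y         = inj₁ x<y
  ... | inj₂ (inj₁ refl) = inj₂ (inj₂ refl)
  ... | inj₂ (inj₂ y<x)  = inj₂ (inj₁ y<x)

  +-monoʳ-< : ∀ z → x < y → z + x < z + y
  +-monoʳ-< {x} {y} z x<y = subst₂ _<_ (+-comm x z) (+-comm y z) (+-mono-< z x<y)

  +-mono-≤-< : x ≤ y → u < v → x + u < y + v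
  +-mono-≤-< {y = y} {u} (inj₁ x<y) u<v = <-trans (+-mono-< u x<y) (+-monoʳ-< y u<v)
  +-mono-≤-< {x}         (inj₂ refl) u<v = +-monoʳ-< x u<v

  x<y⇒pos[y-x] : x < y → Positive (y - x)
  x<y⇒pos[y-x] {x} x<y = subst (_< _) (-‿inverseʳ x) (+-mono-< (- x) x<y)

  pos[y-x]⇒x<y : Positive (y - x) → x < y
  pos[y-x]⇒x<y {y} {x} 0<y-x = subst₂ _<_ (+-identityˡ x) (y-x+x≡y y x) (+-mono-< x 0<y-x)
    where
    y-x+x≡y : ∀ y x → (y - x) + x ≡ y
    y-x+x≡y = solve 2 (λ y x → (y :- x) :+ x := y) refl

  x≤y⇒nonNeg[y-x] : x ≤ y → NonNegative (y - x)
  x≤y⇒nonNeg[y-x]     (inj₁ x<y) = inj₁ (x<y⇒pos[y-x] x<y)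
  x≤y⇒nonNeg[y-x] {x} (inj₂ refl) = inj₂ (sym (-‿inverseʳ x))

  nonNeg[y-x]⇒x≤y : NonNegative (y - x) → x ≤ y
  nonNeg[y-x]⇒x≤y         (inj₁ 0<y-x) = inj₁ (pos[y-x]⇒x<y 0<y-x)
  nonNeg[y-x]⇒x≤y {y} {x} (inj₂ 0≡y-x) = inj₂ (sym (x∙y⁻¹≈ε⇒x≈y y x (sym 0≡y-x)))

  neg<0⇒pos : x < 0# → Positive (- x)
  neg<0⇒pos {x} x<0 = subst Positive (+-identityˡ (- x)) (x<y⇒pos[y-x] x<0)

  neg-mono-< : x < y → - y < - x
  neg-mono-< {x} {y} x<y = pos[y-x]⇒x<y (subst Positive (y-x≡[-x]-[-y] y x) (x<y⇒pos[y-x] x<y))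
    where
    y-x≡[-x]-[-y] : ∀ y x → y - x ≡ - x - - y
    y-x≡[-x]-[-y] = solve 2 (λ y x → y :- x := :- x :- :- y) refl

  pos+pos⇒pos : Positive x → Positive y → Positive (x + y)
  pos+pos⇒pos {x} {y} 0<x 0<y = <-trans 0<y (subst (_< x + y) (+-identityˡ y) (+-mono-< y 0<x))

  pos+nonNeg⇒pos : Positive x → NonNegative y → Positive (x + y)
  pos+nonNeg⇒pos     0<x (inj₁ 0<y)  = pos+pos⇒pos 0<x 0<y
  pos+nonNeg⇒pos {x} 0<x (inj₂ refl) = subst Positive (sym (+-identityʳ x)) 0<x

  nonNeg+nonNeg⇒nonNeg : NonNegative x → NonNegative y → NonNegative (x + y)
  nonNeg+nonNeg⇒nonNeg         (inj₁ 0<x)  0≤y = inj₁ (pos+nonNeg⇒pos 0<x 0≤y)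
  nonNeg+nonNeg⇒nonNeg {y = y} (inj₂ refl) 0≤y = subst NonNegative (sym (+-identityˡ y)) 0≤y

  nonNeg*nonNeg⇒nonNeg : NonNegative x → NonNegative y → NonNegative (x * y)
  nonNeg*nonNeg⇒nonNeg         (inj₁ 0<x)  (inj₁ 0<y)  = inj₁ (*-pos 0<x 0<y)
  nonNeg*nonNeg⇒nonNeg {x}     _           (inj₂ refl) = inj₂ (sym (zeroʳ x))
  nonNeg*nonNeg⇒nonNeg {y = y} (inj₂ refl) _           = inj₂ (sym (zeroˡ y))

  0<1 : Positive 1#
  0<1 with <-trichotomy 0# 1#
  ... | inj₁ 0<1         = 0<1
  ... | inj₂ (inj₁ 0≡1)  = ⊥-elim (0≢1 0≡1)
  ... | inj₂ (inj₂ 1<0)  = ⊥-elim (<-irrefl 1# (<-trans 1<0 (subst Positive -1*-1≡1 (*-pos 0<-1 0<-1))))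
    where
    0<-1 : Positive (- 1#)
    0<-1 = neg<0⇒pos 1<0
    -1*-1≡1 : - 1# * - 1# ≡ 1#
    -1*-1≡1 = solve 0 (:- con (+ 1) :* :- con (+ 1) := con (+ 1)) refl

  square-nonNeg : ∀ x → NonNegative (x * x)
  square-nonNeg x with <-trichotomy 0# x
  ... | inj₁ 0<x         = inj₁ (*-pos 0<x 0<x)
  ... | inj₂ (inj₁ refl) = inj₂ (sym (zeroʳ 0#))
  ... | inj₂ (inj₂ x<0)  = inj₁ (subst Positive (-x*-x≡x*x x) (*-pos (neg<0⇒pos x<0) (neg<0⇒pos x<0)))
    where
    -x*-x≡x*x : ∀ x → - x * - x ≡ x * x
    -x*-x≡x*x = solve 1 (λ x → :- x :* :- x := x :* x) refl

  pos*-cancelˡ : Positive x → Positive (x * y) → Positive y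
  pos*-cancelˡ {x} {y} 0<x 0<xy with <-trichotomy 0# y
  ... | inj₁ 0<y         = 0<y
  ... | inj₂ (inj₁ refl) = ⊥-elim (<-irrefl 0# (subst Positive (zeroʳ x) 0<xy))
  ... | inj₂ (inj₂ y<0)  = ⊥-elim (<-irrefl 0# (subst Positive (xy+x[-y]≡0 x y)
                                                     (pos+pos⇒pos 0<xy (*-pos 0<x (neg<0⇒pos y<0)))))
    where
    xy+x[-y]≡0 : ∀ x y → x * y + x * - y ≡ 0#
    xy+x[-y]≡0 = solve 2 (λ x y → x :* y :+ x :* :- y := con (+ 0)) refl

  pos⇒≢0 : Positive x → x ≢ 0#
  pos⇒≢0 0<x refl = <-irrefl 0# 0<x

  pos⇒⁻¹-pos : Positive x → Positive (x ⁻¹)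
  pos⇒⁻¹-pos 0<x = pos*-cancelˡ 0<x (subst Positive (sym (⁻¹-inverseʳ _ (pos⇒≢0 0<x))) 0<1)

  *-/-cancel : y ≢ 0# → y * (x / y) ≡ x
  *-/-cancel {y} {x} y≢0 = begin
    y * (x * y ⁻¹)   ≡⟨ solve 3 (λ x y y⁻¹ → y :* (x :* y⁻¹) := x :* (y :* y⁻¹)) refl x y (y ⁻¹) ⟩
    x * (y * y ⁻¹)   ≡⟨ cong (x *_) (⁻¹-inverseʳ y y≢0) ⟩
    x * 1#           ≡⟨ *-identityʳ x ⟩
    x                ∎
    where open ≡-Reasoning

  pos/pos⇒pos : Positive x → Positive y → Positive (x / y)
  pos/pos⇒pos 0<x 0<y = *-pos 0<x (pos⇒⁻¹-pos 0<y)

  x<z*y⇒x/y<z : Positive y → x < z * y → x / y < z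
  x<z*y⇒x/y<z {y} {x} {z} 0<y x<zy =
    pos[y-x]⇒x<y (pos*-cancelˡ 0<y (subst Positive (sym y[z-x/y]≡zy-x) (x<y⇒pos[y-x] x<zy)))
    where
    y[z-x/y]≡zy-x : y * (z - x / y) ≡ z * y - x
    y[z-x/y]≡zy-x = begin
      y * (z - x / y)          ≡⟨ solve 3 (λ y z t → y :* (z :- t) := z :* y :- y :* t) refl y z (x / y) ⟩
      z * y - y * (x / y)      ≡⟨ cong (λ t → z * y - t) (*-/-cancel (pos⇒≢0 0<y)) ⟩
      z * y - x                ∎
      where open ≡-Reasoning

  fromℕ-nonNeg : ∀ n → NonNegative (fromℕ n)
  fromℕ-nonNeg zero    = inj₂ refl
  fromℕ-nonNeg (suc n) = inj₁ (pos+nonNeg⇒pos 0<1 (fromℕ-nonNeg n))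

  fromℕ-mono-< : ∀ {m n} → m ℕ.< n → fromℕ m < fromℕ n
  fromℕ-mono-< {zero}  {suc n} _              = pos+nonNeg⇒pos 0<1 (fromℕ-nonNeg n)
  fromℕ-mono-< {suc m} {suc n} (ℕ.s≤s m<n)   = +-monoʳ-< 1# (fromℕ-mono-< m<n)

  ι-suc-pos : ∀ n → Positive (ι +[1+ n ])
  ι-suc-pos n = subst Positive (sym (ι≗fromℤ +[1+ n ])) (fromℕ-mono-< {0} {suc n} (ℕ.s≤s ℕ.z≤n))

  weighted-≤ : ∀ {K J a b c d} → K ℕ.≤ J → c ≤ b → c + d ≤ a + b →
               fromℕ J * c + fromℕ K * d ≤ fromℕ K * a + fromℕ J * b
  weighted-≤ {K} {J} {a} {b} {c} {d} K≤J c≤b c+d≤a+b =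
    nonNeg[y-x]⇒x≤y (subst NonNegative (sym difference)
      (nonNeg+nonNeg⇒nonNeg (nonNeg*nonNeg⇒nonNeg (fromℕ-nonNeg K) (x≤y⇒nonNeg[y-x] c+d≤a+b))
                            (nonNeg*nonNeg⇒nonNeg (fromℕ-nonNeg (J ℕ.∸ K)) (x≤y⇒nonNeg[y-x] c≤b))))
    where
    k e : Carrier
    k = fromℕ K
    e = fromℕ (J ℕ.∸ K)
    j≡k+e : fromℕ J ≡ k + e
    j≡k+e = trans (cong fromℕ (sym (ℕ.m+[n∸m]≡n K≤J))) (fromℕ-+ K (J ℕ.∸ K))
    difference : (k * a + fromℕ J * b) - (fromℕ J * c + k * d) ≡ k * ((a + b) - (c + d)) + e * (b - c)
    difference = begin
      (k * a + fromℕ J * b) - (fromℕ J * c + k * d)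
        ≡⟨ cong (λ j → (k * a + j * b) - (j * c + k * d)) j≡k+e ⟩
      (k * a + (k + e) * b) - ((k + e) * c + k * d)
        ≡⟨ solve 6 (λ k e a b c d → (k :* a :+ (k :+ e) :* b) :- ((k :+ e) :* c :+ k :* d)
                                  := k :* ((a :+ b) :- (c :+ d)) :+ e :* (b :- c)) refl k e a b c d ⟩
      k * ((a + b) - (c + d)) + e * (b - c)
        ∎
      where open ≡-Reasoning

  max-min-weighted-≤ : ∀ K J {a b c d} → c ≤ a → c ≤ b → c + d ≤ a + b →
                       fromℕ (K ℕ.⊔ J) * c + fromℕ (K ℕ.⊓ J) * d ≤ fromℕ K * a + fromℕ J * b
  max-min-weighted-≤ K J {a} {b} {c} {d} c≤a c≤b c+d≤a+b with ℕ.≤-total K J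
  ... | inj₁ K≤J rewrite ℕ.m≤n⇒m⊔n≡n K≤J | ℕ.m≤n⇒m⊓n≡m K≤J = weighted-≤ K≤J c≤b c+d≤a+b
  ... | inj₂ J≤K rewrite ℕ.m≥n⇒m⊔n≡m J≤K | ℕ.m≥n⇒m⊓n≡n J≤K =
    subst (fromℕ K * c + fromℕ J * d ≤_) (+-comm _ _) (weighted-≤ J≤K c≤a (subst (c + d ≤_) (+-comm a b) c+d≤a+b))

module Cubic (R : RealField) where
  open RF R
  open OrderedField R

  -- Completing the square: 4x(x-1) = (2x-1)² - 1.
  4*-pₙ≡ : ∀ n x → ι (+ 4) * - pₙ n x
                   ≡ ι (+ 3) * fromℕ n + x + (ι (+ 2) * x - 1#) * (ι (+ 2) * x - 1#) * (fromℕ n - x)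
  4*-pₙ≡ n x = solve 2 (λ x ν → con (+ 4) :* :- (x :* x :* x :- (con (+ 1) :+ ν) :* (x :* x) :+ ν :* x :- ν)
                             := con (+ 3) :* ν :+ x :+ (con (+ 2) :* x :- con (+ 1)) :* (con (+ 2) :* x :- con (+ 1)) :* (ν :- x))
                       refl x (fromℕ n)

  -pₙ≡ : ∀ n x → - pₙ n x ≡ fromℕ n + - x * (1# + - x) * (fromℕ n - x)
  -pₙ≡ n x = solve 2 (λ x ν → :- (x :* x :* x :- (con (+ 1) :+ ν) :* (x :* x) :+ ν :* x :- ν)
                           := ν :+ :- x :* (con (+ 1) :+ :- x) :* (ν :- x))
                     refl x (fromℕ n)

  x≤n⇒0<-pₙ[x] : ∀ n {x} → Positive (fromℕ n) → x ≤ fromℕ n → Positive (- pₙ n x)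
  x≤n⇒0<-pₙ[x] n {x} 0<n x≤n with <-≤-dichotomy 0# x
  ... | inj₁ 0<x = pos*-cancelˡ (ι-suc-pos 3) (subst Positive (sym (4*-pₙ≡ n x))
      (pos+nonNeg⇒pos (pos+pos⇒pos (*-pos (ι-suc-pos 2) 0<n) 0<x)
                      (nonNeg*nonNeg⇒nonNeg (square-nonNeg _) (x≤y⇒nonNeg[y-x] x≤n))))
  ... | inj₂ x≤0 = subst Positive (sym (-pₙ≡ n x))
      (pos+nonNeg⇒pos 0<n (nonNeg*nonNeg⇒nonNeg (nonNeg*nonNeg⇒nonNeg 0≤-x (inj₁ (pos+nonNeg⇒pos 0<1 0≤-x)))
                                                 (x≤y⇒nonNeg[y-x] x≤n)))
    where
    0≤-x : NonNegative (- x)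
    0≤-x = subst NonNegative (+-identityˡ (- x)) (x≤y⇒nonNeg[y-x] x≤0)

  pₙ[x]≡0⇒n<x : ∀ n {x} → Positive (fromℕ n) → pₙ n x ≡ 0# → fromℕ n < x
  pₙ[x]≡0⇒n<x n {x} 0<n pₙ[x]≡0 with <-≤-dichotomy (fromℕ n) x
  ... | inj₁ n<x = n<x
  ... | inj₂ x≤n = ⊥-elim (<-irrefl 0# (subst Positive -pₙ[x]≡0 (x≤n⇒0<-pₙ[x] n 0<n x≤n)))
    where
    -pₙ[x]≡0 : - pₙ n x ≡ 0#
    -pₙ[x]≡0 = trans (cong (λ p → - p) pₙ[x]≡0) -0#≈0#

module CubicRoot (R : RealField) (n : ℕ) (4≤n : 4 ℕ.≤ n)
                 (β : RealField.Carrier R) (root : RF.pₙ R n β ≡ RealField.0# R) where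
  open RF R
  open OrderedField R
  open Cubic R

  ν α q d₂ : Carrier
  ν  = fromℕ n
  α  = β - ν
  q  = α / β
  d₂ = ν * ν - ι (+ 3) * ν + ι (+ 2)

  0<ν : Positive ν
  0<ν = fromℕ-mono-< (ℕ.≤-trans (ℕ.s≤s ℕ.z≤n) 4≤n)

  0<ν-c : ∀ c → c ℕ.≤ 3 → Positive (ν - ι (+ c))
  0<ν-c c c≤3 = x<y⇒pos[y-x] (subst (_< ν) (sym (ι≗fromℤ (+ c))) (fromℕ-mono-< (ℕ.≤-trans (ℕ.s≤s c≤3) 4≤n)))

  0<ν-1 : Positive (ν - 1#)
  0<ν-1 = 0<ν-c 1 (ℕ.m≤m+n 1 2)

  0<ν-2 : Positive (ν - ι (+ 2))
  0<ν-2 = 0<ν-c 2 (ℕ.m≤m+n 2 1)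

  0<ν-3 : Positive (ν - ι (+ 3))
  0<ν-3 = 0<ν-c 3 ℕ.≤-refl

  0<d₂ : Positive d₂
  0<d₂ = subst Positive (sym (d₂≡ ν)) (*-pos 0<ν-1 0<ν-2)
    where
    d₂≡ : ∀ ν → ν * ν - ι (+ 3) * ν + ι (+ 2) ≡ (ν - 1#) * (ν - ι (+ 2))
    d₂≡ = solve 1 (λ ν → ν :* ν :- con (+ 3) :* ν :+ con (+ 2) := (ν :- con (+ 1)) :* (ν :- con (+ 2))) refl

  0<α : Positive α
  0<α = x<y⇒pos[y-x] (pₙ[x]≡0⇒n<x n 0<ν root)

  1<β : 1# < β
  1<β = pos[y-x]⇒x<y (subst Positive (β-1≡ β ν) (pos+pos⇒pos 0<α 0<ν-1))
    where
    β-1≡ : ∀ β ν → (β - ν) + (ν - 1#) ≡ β - 1#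
    β-1≡ = solve 2 (λ β ν → (β :- ν) :+ (ν :- con (+ 1)) := β :- con (+ 1)) refl

  β[β-1]α≡ν : β * (β - 1#) * α ≡ ν
  β[β-1]α≡ν = begin
    β * (β - 1#) * α    ≡⟨ solve 2 (λ β ν → β :* (β :- con (+ 1)) :* (β :- ν)
                                      := (β :* β :* β :- (con (+ 1) :+ ν) :* (β :* β) :+ ν :* β :- ν) :+ ν) refl β ν ⟩
    pₙ n β + ν          ≡⟨ +-congʳ root ⟩
    0# + ν              ≡⟨ +-identityˡ ν ⟩
    ν                   ∎
    where open ≡-Reasoning

  0<1-α[ν-1] : Positive (1# - α * (ν - 1#))
  0<1-α[ν-1] = pos*-cancelˡ 0<ν (subst Positive (sym ν[1-α[ν-1]]≡)
    (*-pos (*-pos 0<α 0<α) (pos+pos⇒pos (pos+pos⇒pos 0<α 0<ν) 0<ν-1)))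
    where
    ν[1-α[ν-1]]≡ : ν * (1# - α * (ν - 1#)) ≡ α * α * (α + ν + (ν - 1#))
    ν[1-α[ν-1]]≡ = begin
      ν * (1# - α * (ν - 1#))
        ≡⟨ solve 2 (λ β ν → ν :* (con (+ 1) :- (β :- ν) :* (ν :- con (+ 1)))
                          := ν :- ν :* (ν :- con (+ 1)) :* (β :- ν)) refl β ν ⟩
      ν - ν * (ν - 1#) * α
        ≡⟨ cong (λ t → t - ν * (ν - 1#) * α) (sym β[β-1]α≡ν) ⟩
      β * (β - 1#) * α - ν * (ν - 1#) * α
        ≡⟨ solve 2 (λ β ν → β :* (β :- con (+ 1)) :* (β :- ν) :- ν :* (ν :- con (+ 1)) :* (β :- ν)
                          := (β :- ν) :* (β :- ν) :* ((β :- ν) :+ ν :+ (ν :- con (+ 1)))) refl β ν ⟩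
      α * α * (α + ν + (ν - 1#))
        ∎
      where open ≡-Reasoning

  0<β : Positive β
  0<β = <-trans 0<1 1<β

  q*β≡α : q * β ≡ α
  q*β≡α = trans (*-comm q β) (*-/-cancel (pos⇒≢0 0<β))

  0<q : Positive q
  0<q = pos/pos⇒pos 0<α 0<β

  q<α : q < α
  q<α = pos[y-x]⇒x<y (subst Positive (sym α-q≡) (*-pos 0<q (x<y⇒pos[y-x] 1<β)))
    where
    α-q≡ : α - q ≡ q * (β - 1#)
    α-q≡ = begin
      α - q        ≡⟨ cong (λ t → t - q) (sym q*β≡α) ⟩
      q * β - q    ≡⟨ solve 2 (λ q β → q :* β :- q := q :* (β :- con (+ 1))) refl q β ⟩
      q * (β - 1#) ∎
      where open ≡-Reasoning

  0<1-q*d₂ : Positive (1# - q * d₂)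
  0<1-q*d₂ = pos*-cancelˡ 0<β (subst Positive (sym β[1-q*d₂]≡)
    (pos+pos⇒pos (pos+pos⇒pos 0<α (ι-suc-pos 1)) (*-pos 0<ν-2 0<1-α[ν-1])))
    where
    β[1-q*d₂]≡ : β * (1# - q * d₂) ≡ (α + ι (+ 2)) + (ν - ι (+ 2)) * (1# - α * (ν - 1#))
    β[1-q*d₂]≡ = begin
      β * (1# - q * d₂)
        ≡⟨ solve 3 (λ β q ν → β :* (con (+ 1) :- q :* (ν :* ν :- con (+ 3) :* ν :+ con (+ 2)))
                            := β :- q :* β :* (ν :* ν :- con (+ 3) :* ν :+ con (+ 2))) refl β q ν ⟩
      β - q * β * d₂
        ≡⟨ cong (λ t → β - t * d₂) q*β≡α ⟩
      β - α * d₂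
        ≡⟨ solve 2 (λ β ν → β :- (β :- ν) :* (ν :* ν :- con (+ 3) :* ν :+ con (+ 2))
                          := ((β :- ν) :+ con (+ 2)) :+ (ν :- con (+ 2)) :* (con (+ 1) :- (β :- ν) :* (ν :- con (+ 1)))) refl β ν ⟩
      (α + ι (+ 2)) + (ν - ι (+ 2)) * (1# - α * (ν - 1#))
        ∎
      where open ≡-Reasoning

  c₁ c₂ : Carrier
  c₁ = (ν - ι (+ 2)) / (ν - 1#)
  c₂ = (ν * ν - ι (+ 3) * ν + 1#) / d₂

  bound≡ : ∀ m μ → bound n m μ ≡ fromℕ m * c₁ + fromℕ μ * c₂
  bound≡ m μ = cong₂ (λ a b → fromℕ m * a + fromℕ μ * b)
                     (cong₂ _/_ (fromℤ[n-c] 2) (fromℤ[n-c] 1))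
                     (cong₂ _/_ (fromℤ[n²-3n+c] 1) (fromℤ[n²-3n+c] 2))
    where
    fromℤ[n-c] : ∀ c → fromℤ (+ n ℤ.- + c) ≡ ν - ι (+ c)
    fromℤ[n-c] c = trans (fromℤ-‿ (+ n) (+ c)) (cong (λ t → ν - t) (sym (ι≗fromℤ (+ c))))
    fromℤ[n²-3n+c] : ∀ c → fromℤ (+ n ℤ.* + n ℤ.- + 3 ℤ.* + n ℤ.+ + c) ≡ ν * ν - ι (+ 3) * ν + ι (+ c)
    fromℤ[n²-3n+c] c = begin
      fromℤ (+ n ℤ.* + n ℤ.- + 3 ℤ.* + n ℤ.+ + c)
        ≡⟨ fromℤ-+ (+ n ℤ.* + n ℤ.- + 3 ℤ.* + n) (+ c) ⟩
      fromℤ (+ n ℤ.* + n ℤ.- + 3 ℤ.* + n) + fromℤ (+ c)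
        ≡⟨ cong₂ _+_ (fromℤ-‿ (+ n ℤ.* + n) (+ 3 ℤ.* + n)) (sym (ι≗fromℤ (+ c))) ⟩
      fromℤ (+ n ℤ.* + n) - fromℤ (+ 3 ℤ.* + n) + ι (+ c)
        ≡⟨ cong₂ (λ a b → a - b + ι (+ c)) (fromℤ-* (+ n) (+ n))
                 (trans (fromℤ-* (+ 3) (+ n)) (*-congʳ (sym (ι≗fromℤ (+ 3))))) ⟩
      ν * ν - ι (+ 3) * ν + ι (+ c)
        ∎
      where open ≡-Reasoning

  c₁<1-α : c₁ < 1# - α
  c₁<1-α = x<z*y⇒x/y<z 0<ν-1 (pos[y-x]⇒x<y (subst Positive (sym (gap α ν)) 0<1-α[ν-1]))
    where
    gap : ∀ α ν → (1# - α) * (ν - 1#) - (ν - ι (+ 2)) ≡ 1# - α * (ν - 1#)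
    gap = solve 2 (λ α ν → (con (+ 1) :- α) :* (ν :- con (+ 1)) :- (ν :- con (+ 2))
                        := con (+ 1) :- α :* (ν :- con (+ 1))) refl

  c₂<1-q : c₂ < 1# - q
  c₂<1-q = x<z*y⇒x/y<z 0<d₂ (pos[y-x]⇒x<y (subst Positive (sym (gap q ν)) 0<1-q*d₂))
    where
    gap : ∀ q ν → (1# - q) * (ν * ν - ι (+ 3) * ν + ι (+ 2)) - (ν * ν - ι (+ 3) * ν + 1#)
                  ≡ 1# - q * (ν * ν - ι (+ 3) * ν + ι (+ 2))
    gap = solve 2 (λ q ν → (con (+ 1) :- q) :* (ν :* ν :- con (+ 3) :* ν :+ con (+ 2)) :- (ν :* ν :- con (+ 3) :* ν :+ con (+ 1))
                        := con (+ 1) :- q :* (ν :* ν :- con (+ 3) :* ν :+ con (+ 2))) refl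

  c₁<1-q : c₁ < 1# - q
  c₁<1-q = <-trans c₁<1-α (+-monoʳ-< 1# (neg-mono-< q<α))

  1<c₁+c₂ : 1# < c₁ + c₂
  1<c₁+c₂ = pos[y-x]⇒x<y (pos*-cancelˡ 0<d₂ (subst Positive (sym d₂[c₁+c₂-1]≡) (*-pos 0<ν-1 0<ν-3)))
    where
    d₂[c₁+c₂-1]≡ : d₂ * (c₁ + c₂ - 1#) ≡ (ν - 1#) * (ν - ι (+ 3))
    d₂[c₁+c₂-1]≡ = begin
      d₂ * (c₁ + c₂ - 1#)
        ≡⟨ solve 3 (λ ν c₁ c₂ → (ν :* ν :- con (+ 3) :* ν :+ con (+ 2)) :* (c₁ :+ c₂ :- con (+ 1))
                             := (ν :- con (+ 2)) :* ((ν :- con (+ 1)) :* c₁) :+ (ν :* ν :- con (+ 3) :* ν :+ con (+ 2)) :* c₂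
                                :- (ν :* ν :- con (+ 3) :* ν :+ con (+ 2))) refl ν c₁ c₂ ⟩
      (ν - ι (+ 2)) * ((ν - 1#) * c₁) + d₂ * c₂ - d₂
        ≡⟨ cong₂ (λ a b → (ν - ι (+ 2)) * a + b - d₂) (*-/-cancel (pos⇒≢0 0<ν-1)) (*-/-cancel (pos⇒≢0 0<d₂)) ⟩
      (ν - ι (+ 2)) * (ν - ι (+ 2)) + (ν * ν - ι (+ 3) * ν + 1#) - d₂
        ≡⟨ solve 1 (λ ν → (ν :- con (+ 2)) :* (ν :- con (+ 2)) :+ (ν :* ν :- con (+ 3) :* ν :+ con (+ 1))
                          :- (ν :* ν :- con (+ 3) :* ν :+ con (+ 2))
                       := (ν :- con (+ 1)) :* (ν :- con (+ 3))) refl ν ⟩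
      (ν - 1#) * (ν - ι (+ 3))
        ∎
      where open ≡-Reasoning

  0<c₁ : Positive c₁
  0<c₁ = pos/pos⇒pos 0<ν-2 0<ν-1

  0<c₂ : Positive c₂
  0<c₂ = pos/pos⇒pos (subst Positive (sym (≡ν[ν-3]+1 ν)) (pos+pos⇒pos (*-pos 0<ν 0<ν-3) 0<1)) 0<d₂
    where
    ≡ν[ν-3]+1 : ∀ ν → ν * ν - ι (+ 3) * ν + 1# ≡ ν * (ν - ι (+ 3)) + 1#
    ≡ν[ν-3]+1 = solve 1 (λ ν → ν :* ν :- con (+ 3) :* ν :+ con (+ 1) := ν :* (ν :- con (+ 3)) :+ con (+ 1)) refl

  σ : ℕ → ℕ → Carrier
  σ K J = fromℕ K * (1# - α) + fromℕ J * (1# - q)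

  bound≤σ : ∀ K J → bound n (K ℕ.⊔ J) (K ℕ.⊓ J) ≤ σ K J
  bound≤σ K J = subst (_≤ σ K J) (sym (bound≡ (K ℕ.⊔ J) (K ℕ.⊓ J)))
    (max-min-weighted-≤ K J (inj₁ c₁<1-α) (inj₁ c₁<1-q) (inj₁ (+-mono-≤-< (inj₁ c₁<1-α) c₂<1-q)))

  0<bound-1 : ∀ m μ → Positive (bound n (suc m) (suc μ) - 1#)
  0<bound-1 m μ =
    subst Positive (sym (trans (+-congʳ (bound≡ (suc m) (suc μ))) (regroup (fromℕ m) (fromℕ μ) c₁ c₂)))
    (pos+nonNeg⇒pos (x<y⇒pos[y-x] 1<c₁+c₂)
      (nonNeg+nonNeg⇒nonNeg (nonNeg*nonNeg⇒nonNeg (fromℕ-nonNeg m) (inj₁ 0<c₁))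
                            (nonNeg*nonNeg⇒nonNeg (fromℕ-nonNeg μ) (inj₁ 0<c₂))))
    where
    regroup : ∀ m μ c₁ c₂ → (1# + m) * c₁ + (1# + μ) * c₂ - 1# ≡ (c₁ + c₂ - 1#) + (m * c₁ + μ * c₂)
    regroup = solve 4 (λ m μ c₁ c₂ → (con (+ 1) :+ m) :* c₁ :+ (con (+ 1) :+ μ) :* c₂ :- con (+ 1)
                                  := (c₁ :+ c₂ :- con (+ 1)) :+ (m :* c₁ :+ μ :* c₂)) refl

  fromℤ[k-j-l]≡ : ∀ l k j → fromℤ (k ℤ.- j ℤ.- l) ≡ (1# - α) * fromℤ k - (1# - q) * fromℤ j - f n β l k j
  fromℤ[k-j-l]≡ l k j = begin
    fromℤ (k ℤ.- j ℤ.- l)            ≡⟨ fromℤ-‿ (k ℤ.- j) l ⟩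
    fromℤ (k ℤ.- j) - fromℤ l        ≡⟨ +-congʳ (fromℤ-‿ k j) ⟩
    fromℤ k - fromℤ j - fromℤ l      ≡⟨ solve 5 (λ k j l α q → k :- j :- l
                                          := (con (+ 1) :- α) :* k :- (con (+ 1) :- q) :* j :- (l :- α :* k :+ q :* j))
                                          refl (fromℤ k) (fromℤ j) (fromℤ l) α q ⟩
    (1# - α) * fromℤ k - (1# - q) * fromℤ j - f n β l k j ∎
    where open ≡-Reasoning

  k>0>j⇒bound-1<k-j-l : ∀ {l k j} → f n β l k j < 1# → k ℤ.> + 0 → j ℤ.< + 0 →
                         bound n (ℤ.∣ k ∣ ℕ.⊔ ℤ.∣ j ∣) (ℤ.∣ k ∣ ℕ.⊓ ℤ.∣ j ∣) - 1# < fromℤ (k ℤ.- j ℤ.- l)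
                         × Positive (bound n (ℤ.∣ k ∣ ℕ.⊔ ℤ.∣ j ∣) (ℤ.∣ k ∣ ℕ.⊓ ℤ.∣ j ∣) - 1#)
  k>0>j⇒bound-1<k-j-l {l} {+[1+ K ]} { -[1+ J ]} f<1 _ _ =
    subst (_ <_) (sym fromℤ[k-j-l]≡σ-f) (+-mono-≤-< (bound≤σ (suc K) (suc J)) (neg-mono-< f<1)) ,
    0<bound-1 (K ℕ.⊔ J) (K ℕ.⊓ J)
    where
    fromℤ[k-j-l]≡σ-f : fromℤ (+[1+ K ] ℤ.- -[1+ J ] ℤ.- l) ≡ σ (suc K) (suc J) - f n β l +[1+ K ] -[1+ J ]
    fromℤ[k-j-l]≡σ-f = trans (fromℤ[k-j-l]≡ l +[1+ K ] -[1+ J ])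
      (solve 5 (λ k j α q φ → (con (+ 1) :- α) :* k :- (con (+ 1) :- q) :* :- j :- φ
                            := k :* (con (+ 1) :- α) :+ j :* (con (+ 1) :- q) :- φ)
             refl (fromℕ (suc K)) (fromℕ (suc J)) α q (f n β l +[1+ K ] -[1+ J ]))
  k>0>j⇒bound-1<k-j-l {k = + 0}      _ (ℤ.+<+ ()) _
  k>0>j⇒bound-1<k-j-l {k = -[1+ _ ]} _ () _
  k>0>j⇒bound-1<k-j-l {k = +[1+ _ ]} {+ _} _ _ (ℤ.+<+ ())

  k<0<j⇒k-j-l<-bound : ∀ {l k j} → Positive (f n β l k j) → k ℤ.< + 0 → j ℤ.> + 0 →
                        fromℤ (k ℤ.- j ℤ.- l) < - bound n (ℤ.∣ k ∣ ℕ.⊔ ℤ.∣ j ∣) (ℤ.∣ k ∣ ℕ.⊓ ℤ.∣ j ∣)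
  k<0<j⇒k-j-l<-bound {l} { -[1+ K ]} {+[1+ J ]} 0<f _ _ =
    subst (_< _) (sym fromℤ[k-j-l]≡-[σ+f])
      (neg-mono-< (subst (_< σ (suc K) (suc J) + f n β l -[1+ K ] +[1+ J ]) (+-identityʳ _)
                         (+-mono-≤-< (bound≤σ (suc K) (suc J)) 0<f)))
    where
    fromℤ[k-j-l]≡-[σ+f] : fromℤ (-[1+ K ] ℤ.- +[1+ J ] ℤ.- l) ≡ - (σ (suc K) (suc J) + f n β l -[1+ K ] +[1+ J ])
    fromℤ[k-j-l]≡-[σ+f] = trans (fromℤ[k-j-l]≡ l -[1+ K ] +[1+ J ])
      (solve 5 (λ k j α q φ → (con (+ 1) :- α) :* :- k :- (con (+ 1) :- q) :* j :- φ
                            := :- (k :* (con (+ 1) :- α) :+ j :* (con (+ 1) :- q) :+ φ))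
             refl (fromℕ (suc K)) (fromℕ (suc J)) α q (f n β l -[1+ K ] +[1+ J ]))
  k<0<j⇒k-j-l<-bound {k = + _}      _ (ℤ.+<+ ()) _
  k<0<j⇒k-j-l<-bound {k = -[1+ _ ]} {+ 0}      _ _ (ℤ.+<+ ())
  k<0<j⇒k-j-l<-bound {k = -[1+ _ ]} { -[1+ _ ]} _ _ ()

-- Imported only here: these _≤_, _-_ and _<_ would clash with the field's operators above.
open import Data.Nat using (ℕ; _≤_)
open import Data.Integer using (ℤ; +_; _-_; ∣_∣; _<_; _>_)
open import Data.Nat using (_⊔_; _⊓_)
open import Data.Product using (_×_)

lemma3p7 : (R : RealField) (n : ℕ) → 4 ≤ n →
             (β : RealField.Carrier R) → RF.IsLargestRoot R (RF.pₙ R n) β →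
             (l k j : ℤ) →
             RF._<_ R (RF.0# R) (RF.f R n β l k j) → RF._<_ R (RF.f R n β l k j) (RF.1# R) →
             ((k > + 0 → j < + 0 →
                 RF._<_ R (RF._-_ R (RF.bound R n (∣ k ∣ ⊔ ∣ j ∣) (∣ k ∣ ⊓ ∣ j ∣)) (RF.1# R)) (RF.fromℤ R (k - j - l))
               × RF._<_ R (RF.0# R) (RF._-_ R (RF.bound R n (∣ k ∣ ⊔ ∣ j ∣) (∣ k ∣ ⊓ ∣ j ∣)) (RF.1# R)))
             × (k < + 0 → j > + 0 →
                 RF._<_ R (RF.fromℤ R (k - j - l)) (RF.-_ R (RF.bound R n (∣ k ∣ ⊔ ∣ j ∣) (∣ k ∣ ⊓ ∣ j ∣)))))
lemma3p7 R n 4≤n β (root , _) l k j 0<f f<1 = k>0>j⇒bound-1<k-j-l f<1 , k<0<j⇒k-j-l<-bound 0<f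
  where open CubicRoot R n 4≤n β root
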